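{- There is a $\frac{3}{2}$-competitive online algorithm with advice for multi-coloring hexagonal graphs with advice complexity $[\![\lceil \mathrm{Opt}/2\rceil]\!]$.
   Context: A hexagonal graph is a graph obtained by placing at most one node in each cell of a hexagonal grid and adding an edge between every pair of nodes in neighboring cells. Online multi-coloring: the graph is known in advance; requests arrive one at a time, each naming a node $v$, and must immediately and irrevocably receive a color (positive integer) different from every color previously assigned to $v$ or any neighbor of $v$. $A(I)$ is the number of colors used and $\mathrm{Opt}=\mathrm{Opt}(I)$ the minimum number an offline algorithm needs. Advice model: an all-powerful oracle knowing $I$ writes an infinite binary advice tape; advice complexity is the maximum index of a bit read. $A$ is $c$-competitive if there is a constant $\alpha$ with $A(I)\le c\cdot\mathrm{Opt}(I)+\alpha$ for all $I$. $[\![x]\!]$ denotes the minimum number of bits needed to encode the non-negative integer $x$ in a self-delimiting way. -}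

module Defs where

open import Data.Bool using (Bool)
open import Data.Nat using (ℕ; zero; suc; _+_; _*_; _≤_; _<_; ⌈_/2⌉)
open import Data.Nat.Logarithm using (⌈log₂_⌉)
open import Data.Integer using (ℤ; +_; -[1+_]) renaming (_+_ to _+ℤ_)
open import Data.Product using (_×_; _,_; Σ; ∃)
open import Data.Sum using (_⊎_)
open import Data.Unit using (⊤)
open import Data.List using (List; []; _∷_; _++_; [_]; length; zip; deduplicate)
open import Data.List.Relation.Unary.All using (All)
open import Data.List.Relation.Unary.AllPairs using (AllPairs)
open import Data.List.Membership.Propositional using (_∈_)
open import Relation.Binary.PropositionalEquality using (_≡_; _≢_)
import Data.Nat as ℕ

-- Hexagonal grid: cells in axial coordinates (q , r).  The six
-- neighbours of (q , r) are (q±1 , r), (q , r±1), (q+1 , r-1), (q-1 , r+1).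

Cell : Set
Cell = ℤ × ℤ

data Offset : ℤ → ℤ → Set where
  e  : Offset (+ 1) (+ 0)
  w  : Offset -[1+ 0 ] (+ 0)
  ne : Offset (+ 0) (+ 1)
  sw : Offset (+ 0) -[1+ 0 ]
  nw : Offset (+ 1) -[1+ 0 ]
  se : Offset -[1+ 0 ] (+ 1)

Adjacent : Cell → Cell → Set
Adjacent (q , r) (q' , r') = Σ ℤ λ dq → Σ ℤ λ dr → Offset dq dr × (q' ≡ q +ℤ dq) × (r' ≡ r +ℤ dr)

-- A hexagonal graph: a finite set of occupied cells (at most one node per
-- cell, so nodes are identified with their cells); edges join nodes in
-- neighbouring cells.
HexGraph : Set
HexGraph = List Cell

Conflict : Cell → Cell → Set
Conflict u v = (u ≡ v) ⊎ Adjacent u v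

ValidRequests : HexGraph → List Cell → Set
ValidRequests G rs = All (λ v → v ∈ G) rs

Proper : List (Cell × ℕ) → Set
Proper xs = All (λ p → 1 ≤ Data.Product.proj₂ p) xs
          × AllPairs (λ p p' → Conflict (Data.Product.proj₁ p) (Data.Product.proj₁ p')
                               → Data.Product.proj₂ p ≢ Data.Product.proj₂ p') xs

numColours : List ℕ → ℕ
numColours cs = length (deduplicate ℕ._≟_ cs)

IsColouring : List Cell → List ℕ → Set
IsColouring rs cs = (length cs ≡ length rs) × Proper (zip rs cs)

IsOpt : List Cell → ℕ → Set
IsOpt rs k = (Σ (List ℕ) λ cs → IsColouring rs cs × numColours cs ≡ k)
           × ((cs : List ℕ) → IsColouring rs cs → k ≤ numColours cs)

-- The advice tape; position p holds the bit with index p + 1.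
Tape : Set
Tape = ℕ → Bool

-- A deterministic computation that may read bits of the tape
-- (adaptively, in any order) before producing an answer.
data Query (A : Set) : Set where
  answer : A → Query A
  read   : ℕ → (Bool → Query A) → Query A

eval : {A : Set} → Query A → Tape → A
eval (answer a) t = a
eval (read p k) t = eval (k (t p)) t

ReadsWithin : {A : Set} → ℕ → Query A → Tape → Set
ReadsWithin b (answer a) t = ⊤
ReadsWithin b (read p k) t = (suc p ≤ b) × ReadsWithin b (k (t p)) t

-- An online algorithm with advice: knowing the graph in advance, the
-- previous requests, and the current request, it computes (possibly
-- reading advice) the colour of the current request.  Its own earlier
-- colours are determined by these data, and it may re-read the tape.
OnlineAlg : Set
OnlineAlg = HexGraph → List Cell → Cell → Query ℕ

steps : OnlineAlg → HexGraph → List Cell → List Cell → List (Query ℕ)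
steps A G pre []       = []
steps A G pre (v ∷ vs) = A G pre v ∷ steps A G (pre ++ [ v ]) vs

run : OnlineAlg → Tape → HexGraph → List Cell → List ℕ
run A t G rs = Data.List.map (λ q → eval q t) (steps A G [] rs)

AdviceWithin : OnlineAlg → Tape → HexGraph → List Cell → ℕ → Set
AdviceWithin A t G rs b = All (λ q → ReadsWithin b q t) (steps A G [] rs)

-- [[x]]: bits for a self-delimiting encoding of x (convention of the
-- advice literature): ⌈log(x+1)⌉ + 2⌈log(⌈log(x+1)⌉+1)⌉.
⟦_⟧ : ℕ → ℕ
⟦ x ⟧ = ⌈log₂ (suc x) ⌉ + 2 * ⌈log₂ (suc ⌈log₂ (suc x) ⌉) ⌉

module Submission where

-- The grid is properly 3-coloured by the residue of q - r modulo 3; class a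
-- owns the palette 3j + a + 1 (j ≥ 0).  The (j+1)-st request to a node of
-- class a gets its own j-th colour if j < k, and otherwise colour 2k-1-j of
-- the next class's palette.  A node, and two adjacent nodes together, get at
-- most Opt ≤ 2k requests (they are cliques of the conflict graph), so this is
-- a proper colouring with colours in [1, 3k], whence 2·A ≤ 3·Opt + 3.

open import Defs
open import Data.Nat using (ℕ; zero; suc; pred; _+_; _*_; _^_; _≤_; _<_; z≤n; s≤s; z<s; _<?_; ⌈_/2⌉; ⌊_/2⌋)
import Data.Nat as ℕ
import Data.Nat.Properties as ℕ
open import Data.Nat.Logarithm using (⌈log₂_⌉; ⌈log₂⌉-mono-≤)
open import Data.Nat.Logarithm.Core using (⌈log2⌉)
open import Data.Nat.Induction using (<-wellFounded)
open import Induction.WellFounded using (Acc; acc)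
import Data.Nat.Tactic.RingSolver as ℕ-Solver
open import Data.Integer as ℤ using (ℤ; +_; -[1+_])
import Data.Integer.Properties as ℤ
import Data.Integer.Tactic.RingSolver as ℤ-Solver
open import Data.Bool using (Bool; true; false; if_then_else_)
open import Data.Maybe using (Maybe; just; nothing; maybe)
import Data.Maybe as Maybe
open import Data.Vec using (Vec; []; _∷_)
open import Data.Product using (Σ; _×_; _,_; proj₁; proj₂)
open import Data.Product.Properties using (≡-dec)
open import Data.Sum using (_⊎_; inj₁; inj₂)
open import Data.Unit using (tt)
open import Data.Empty using (⊥-elim)
open import Function using (_∘_)
open import Data.List using (List; []; _∷_; _++_; [_]; length; zip; filter; map; applyUpTo)
open import Data.List.Properties using (++-assoc; ++-identityʳ; filter-++; filter-accept; length-++; length-map; length-applyUpTo; length-removeAt′)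
open import Data.List.Relation.Unary.All using (All; []; _∷_)
import Data.List.Relation.Unary.All as All
open import Data.List.Relation.Unary.All.Properties using (all-filter)
open import Data.List.Relation.Unary.Any using (here; there; index; _─_)
open import Data.List.Relation.Unary.AllPairs using (AllPairs; []; _∷_)
import Data.List.Relation.Unary.AllPairs.Properties as AllPairs
open import Data.List.Relation.Unary.Unique.Propositional using (Unique)
open import Data.List.Relation.Unary.Unique.DecPropositional.Properties ℕ._≟_ using (deduplicate-!)
open import Data.List.Membership.Propositional using (_∈_)
open import Data.List.Membership.Propositional.Properties using (∈-map⁻; ∈-filter⁻; ∈-deduplicate⁺; ∈-deduplicate⁻; ∈-applyUpTo⁺)
open import Relation.Binary.PropositionalEquality using (_≡_; _≢_; refl; sym; trans; cong; cong₂; subst; module ≡-Reasoning)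
open import Relation.Binary.Definitions using (DecidableEquality)
open import Relation.Unary using (Decidable)
open import Relation.Nullary using (yes; no; does; ¬_; contradiction)
open import Relation.Nullary.Decidable using (_⊎-dec_)

private
  variable
    A B : Set

data ℤ₃ : Set where
  0₃ 1₃ 2₃ : ℤ₃

suc₃ pred₃ : ℤ₃ → ℤ₃
suc₃ 0₃ = 1₃
suc₃ 1₃ = 2₃
suc₃ 2₃ = 0₃
pred₃ 0₃ = 2₃
pred₃ 1₃ = 0₃
pred₃ 2₃ = 1₃

suc₃-pred₃ : ∀ a → suc₃ (pred₃ a) ≡ a
suc₃-pred₃ 0₃ = refl
suc₃-pred₃ 1₃ = refl
suc₃-pred₃ 2₃ = refl

pred₃-suc₃ : ∀ a → pred₃ (suc₃ a) ≡ a
pred₃-suc₃ 0₃ = refl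
pred₃-suc₃ 1₃ = refl
pred₃-suc₃ 2₃ = refl

suc₃-moves : ∀ a → suc₃ a ≢ a
suc₃-moves 0₃ ()
suc₃-moves 1₃ ()
suc₃-moves 2₃ ()

pred₃-moves : ∀ a → pred₃ a ≢ a
pred₃-moves 0₃ ()
pred₃-moves 1₃ ()
pred₃-moves 2₃ ()

posRes negRes : ℕ → ℤ₃
posRes zero = 0₃
posRes (suc n) = suc₃ (posRes n)
negRes zero = 0₃
negRes (suc n) = pred₃ (negRes n)

residue : ℤ → ℤ₃
residue (+ n) = posRes n
residue -[1+ n ] = negRes (suc n)

-- n + 1 is not definitionally suc n, hence this induction
posRes-+1 : ∀ n → posRes (n + 1) ≡ suc₃ (posRes n)
posRes-+1 zero = refl
posRes-+1 (suc n) = cong suc₃ (posRes-+1 n)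

residue-+1 : ∀ x → residue (x ℤ.+ + 1) ≡ suc₃ (residue x)
residue-+1 (+ n) = posRes-+1 n
residue-+1 -[1+ zero ] = refl
residue-+1 -[1+ suc n ] = sym (suc₃-pred₃ (negRes (suc n)))

residue--1 : ∀ x → residue (x ℤ.+ -[1+ 0 ]) ≡ pred₃ (residue x)
residue--1 (+ zero) = refl
residue--1 (+ suc n) = sym (pred₃-suc₃ (posRes n))
residue--1 -[1+ n ] rewrite ℕ.+-identityʳ n = refl

residue-+2 : ∀ x → residue (x ℤ.+ + 2) ≡ suc₃ (suc₃ (residue x))
residue-+2 x = begin
  residue (x ℤ.+ + 2)                ≡⟨ cong residue (sym (ℤ.+-assoc x (+ 1) (+ 1))) ⟩
  residue ((x ℤ.+ + 1) ℤ.+ + 1)      ≡⟨ residue-+1 (x ℤ.+ + 1) ⟩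
  suc₃ (residue (x ℤ.+ + 1))         ≡⟨ cong suc₃ (residue-+1 x) ⟩
  suc₃ (suc₃ (residue x))            ∎
  where open ≡-Reasoning

residue--2 : ∀ x → residue (x ℤ.+ -[1+ 1 ]) ≡ pred₃ (pred₃ (residue x))
residue--2 x = begin
  residue (x ℤ.+ -[1+ 1 ])                   ≡⟨ cong residue (sym (ℤ.+-assoc x -[1+ 0 ] -[1+ 0 ])) ⟩
  residue ((x ℤ.+ -[1+ 0 ]) ℤ.+ -[1+ 0 ])    ≡⟨ residue--1 (x ℤ.+ -[1+ 0 ]) ⟩
  pred₃ (residue (x ℤ.+ -[1+ 0 ]))           ≡⟨ cong pred₃ (residue--1 x) ⟩
  pred₃ (pred₃ (residue x))                  ∎
  where open ≡-Reasoning

-- Moving to a neighbouring cell changes q - r by one of these amounts.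
data Step : ℤ → Set where
  up₁   : Step (+ 1)
  down₁ : Step -[1+ 0 ]
  up₂   : Step (+ 2)
  down₂ : Step -[1+ 1 ]

offset-step : ∀ {dq dr} → Offset dq dr → Step (dq ℤ.- dr)
offset-step e  = up₁
offset-step w  = down₁
offset-step ne = down₁
offset-step sw = up₁
offset-step nw = up₂
offset-step se = down₂

step-moves : ∀ {d} → Step d → ∀ x → residue (x ℤ.+ d) ≢ residue x
step-moves up₁   x eq = suc₃-moves (residue x) (trans (sym (residue-+1 x)) eq)
step-moves down₁ x eq = pred₃-moves (residue x) (trans (sym (residue--1 x)) eq)
step-moves up₂   x eq = pred₃-moves (residue x) (trans (twice-up (residue x)) (trans (sym (residue-+2 x)) eq))
  where
  twice-up : ∀ a → pred₃ a ≡ suc₃ (suc₃ a)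
  twice-up 0₃ = refl
  twice-up 1₃ = refl
  twice-up 2₃ = refl
step-moves down₂ x eq = suc₃-moves (residue x) (trans (twice-down (residue x)) (trans (sym (residue--2 x)) eq))
  where
  twice-down : ∀ a → suc₃ a ≡ pred₃ (pred₃ a)
  twice-down 0₃ = refl
  twice-down 1₃ = refl
  twice-down 2₃ = refl

cellClass : Cell → ℤ₃
cellClass (q , r) = residue (q ℤ.- r)

adjacent-classes-differ : ∀ u v → Adjacent u v → cellClass u ≢ cellClass v
adjacent-classes-differ (q , r) _ (dq , dr , o , refl , refl) same =
  step-moves (offset-step o) (q ℤ.- r) (begin
    residue ((q ℤ.- r) ℤ.+ (dq ℤ.- dr))   ≡⟨ cong residue (sym (rearrange q dq r dr)) ⟩
    residue ((q ℤ.+ dq) ℤ.- (r ℤ.+ dr))   ≡⟨ sym same ⟩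
    residue (q ℤ.- r)                     ∎)
  where
  open ≡-Reasoning
  rearrange : ∀ a b c d → (a ℤ.+ b) ℤ.- (c ℤ.+ d) ≡ (a ℤ.- c) ℤ.+ (b ℤ.- d)
  rearrange = ℤ-Solver.solve-∀

adjacent-sym : ∀ u v → Adjacent u v → Adjacent v u
adjacent-sym (q , r) _ (dq , dr , o , refl , refl) =
  ℤ.- dq , ℤ.- dr , opposite o , undo q dq , undo r dr
  where
  opposite : ∀ {a b} → Offset a b → Offset (ℤ.- a) (ℤ.- b)
  opposite e  = w
  opposite w  = e
  opposite ne = sw
  opposite sw = ne
  opposite nw = se
  opposite se = nw
  undo : ∀ x d → x ≡ (x ℤ.+ d) ℤ.+ ℤ.- d
  undo = ℤ-Solver.solve-∀

_≟ᶜ_ : DecidableEquality Cell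
_≟ᶜ_ = ≡-dec ℤ._≟_ ℤ._≟_

count : Cell → List Cell → ℕ
count v xs = length (filter (_≟ᶜ v) xs)

count-++ : ∀ v xs ys → count v (xs ++ ys) ≡ count v xs + count v ys
count-++ v xs ys = trans (cong length (filter-++ (_≟ᶜ v) xs ys)) (length-++ (filter (_≟ᶜ v) xs))

∈-─ : ∀ {x z : A} {ys} (x∈ys : x ∈ ys) → z ∈ ys → z ≢ x → z ∈ (ys ─ x∈ys)
∈-─ (here refl) (here refl) z≢x = ⊥-elim (z≢x refl)
∈-─ (here refl) (there z∈ys) z≢x = z∈ys
∈-─ (there x∈ys) (here refl) z≢x = here refl
∈-─ (there x∈ys) (there z∈ys) z≢x = there (∈-─ x∈ys z∈ys z≢x)

unique-⊆-length : ∀ {xs ys : List A} → Unique xs → (∀ {z} → z ∈ xs → z ∈ ys) → length xs ≤ length ys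
unique-⊆-length {xs = []} _ _ = z≤n
unique-⊆-length {xs = x ∷ xs} {ys} (x≢xs ∷ unique) xs⊆ys = begin
  suc (length xs)           ≤⟨ s≤s (unique-⊆-length unique rest⊆) ⟩
  suc (length (ys ─ x∈ys))  ≡⟨ sym (length-removeAt′ ys (index x∈ys)) ⟩
  length ys                 ∎
  where
  open ℕ.≤-Reasoning
  x∈ys = xs⊆ys (here refl)
  rest⊆ : ∀ {z} → z ∈ xs → z ∈ (ys ─ x∈ys)
  rest⊆ z∈xs = ∈-─ x∈ys (xs⊆ys (there z∈xs)) (λ z≡x → All.lookup x≢xs z∈xs (sym z≡x))

restrict : ∀ {P : A → Set} {R S : A → A → Set} {xs} → All P xs → AllPairs R xs →
           (∀ {x y} → P x → P y → R x y → S x y) → AllPairs S xs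
restrict [] [] _ = []
restrict (px ∷ pxs) (rx ∷ rxs) weaken =
  All.zipWith (λ (py , r) → weaken px py r) (pxs , rx) ∷ restrict pxs rxs weaken

zip-proj₂ : ∀ {p : A × B} {xs ys} → p ∈ zip xs ys → proj₂ p ∈ ys
zip-proj₂ {xs = _ ∷ _} {_ ∷ _} (here refl) = here refl
zip-proj₂ {xs = _ ∷ _} {_ ∷ _} (there p∈) = there (zip-proj₂ p∈)

filter-zip-length : ∀ {P : A → Set} (P? : Decidable P) {xs : List A} {ys : List B} →
  length ys ≡ length xs → length (filter (λ p → P? (proj₁ p)) (zip xs ys)) ≡ length (filter P? xs)
filter-zip-length P? {[]} {[]} _ = refl
filter-zip-length P? {x ∷ xs} {_ ∷ ys} eq with does (P? x)
... | true  = cong suc (filter-zip-length P? {xs} {ys} (ℕ.suc-injective eq))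
... | false = filter-zip-length P? {xs} {ys} (ℕ.suc-injective eq)

Clique : (Cell → Set) → Set
Clique C = ∀ {x y} → C x → C y → Conflict x y

-- Requests to a clique need pairwise distinct colours.
clique-bound : ∀ {C : Cell → Set} (C? : Decidable C) → Clique C →
               ∀ {rs cs} → IsColouring rs cs → length (filter C? rs) ≤ numColours cs
clique-bound C? clique {rs} {cs} (same-length , _ , compatible) = begin
  length (filter C? rs)         ≡⟨ sym (filter-zip-length C? {rs} {cs} same-length) ⟩
  length selected               ≡⟨ sym (length-map proj₂ selected) ⟩
  length (map proj₂ selected)   ≤⟨ unique-⊆-length distinct (λ z∈ → ∈-deduplicate⁺ ℕ._≟_ (selected-⊆ z∈)) ⟩
  numColours cs                 ∎
  where
  open ℕ.≤-Reasoning
  selected = filter (λ p → C? (proj₁ p)) (zip rs cs)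
  distinct : Unique (map proj₂ selected)
  distinct = AllPairs.map⁺ (restrict (all-filter (λ p → C? (proj₁ p)) (zip rs cs))
                                      (AllPairs.filter⁺ (λ p → C? (proj₁ p)) compatible)
                                      (λ cx cy differ → differ (clique cx cy)))
  selected-⊆ : ∀ {z} → z ∈ map proj₂ selected → z ∈ cs
  selected-⊆ z∈ with ∈-map⁻ proj₂ z∈
  ... | _ , p∈ , refl = zip-proj₂ {xs = rs} (proj₁ (∈-filter⁻ (λ p → C? (proj₁ p)) {xs = zip rs cs} p∈))

-- All requests to one node form a clique.
occurrences-≤-opt : ∀ {rs opt} → IsOpt rs opt → ∀ v → count v rs ≤ opt
occurrences-≤-opt ((cs , colouring , refl) , _) v =
  clique-bound (_≟ᶜ v) (λ x≡v y≡v → inj₁ (trans x≡v (sym y≡v))) colouring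

count-pair : ∀ {u v} → u ≢ v → ∀ xs →
  length (filter (λ x → (x ≟ᶜ u) ⊎-dec (x ≟ᶜ v)) xs) ≡ count u xs + count v xs
count-pair u≢v [] = refl
count-pair {u} {v} u≢v (x ∷ xs) with x ≟ᶜ u | x ≟ᶜ v
... | yes refl | yes refl = ⊥-elim (u≢v refl)
... | yes _    | no _     = cong suc (count-pair u≢v xs)
... | no _     | yes _    = trans (cong suc (count-pair u≢v xs)) (sym (ℕ.+-suc (count u xs) (count v xs)))
... | no _     | no _     = count-pair u≢v xs

-- All requests to two adjacent nodes form a clique.
adjacent-occurrences-≤-opt : ∀ {rs opt} → IsOpt rs opt → ∀ u v → Adjacent u v → count u rs + count v rs ≤ opt
adjacent-occurrences-≤-opt {rs} ((cs , colouring , refl) , _) u v adj =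
  subst (_≤ numColours cs) (count-pair u≢v rs)
    (clique-bound (λ x → (x ≟ᶜ u) ⊎-dec (x ≟ᶜ v)) clique colouring)
  where
  u≢v : u ≢ v
  u≢v u≡v = adjacent-classes-differ u v adj (cong cellClass u≡v)
  clique : Clique (λ x → x ≡ u ⊎ x ≡ v)
  clique (inj₁ refl) (inj₁ refl) = inj₁ refl
  clique (inj₁ refl) (inj₂ refl) = inj₂ adj
  clique (inj₂ refl) (inj₁ refl) = inj₂ (adjacent-sym u v adj)
  clique (inj₂ refl) (inj₂ refl) = inj₁ refl

classIndex : ℤ₃ → ℕ
classIndex 0₃ = 0
classIndex 1₃ = 1
classIndex 2₃ = 2

classIndex-injective : ∀ a b → classIndex a ≡ classIndex b → a ≡ b
classIndex-injective 0₃ 0₃ _ = refl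
classIndex-injective 1₃ 1₃ _ = refl
classIndex-injective 2₃ 2₃ _ = refl
classIndex-injective 0₃ 1₃ ()
classIndex-injective 0₃ 2₃ ()
classIndex-injective 1₃ 0₃ ()
classIndex-injective 1₃ 2₃ ()
classIndex-injective 2₃ 0₃ ()
classIndex-injective 2₃ 1₃ ()

palette : ℕ → ℤ₃ → ℕ
palette zero a = suc (classIndex a)
palette (suc j) a = 3 + palette j a

palette-≥1 : ∀ j a → 1 ≤ palette j a
palette-≥1 zero a = s≤s z≤n
palette-≥1 (suc j) a = s≤s z≤n

palette-≤ : ∀ j a → palette j a ≤ 3 * suc j
palette-≤ zero 0₃ = s≤s z≤n
palette-≤ zero 1₃ = s≤s (s≤s z≤n)
palette-≤ zero 2₃ = s≤s (s≤s (s≤s z≤n))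
palette-≤ (suc j) a = subst (palette (suc j) a ≤_) (sym (ℕ.*-suc 3 (suc j))) (ℕ.+-monoʳ-≤ 3 (palette-≤ j a))

palette-injective : ∀ i j a b → palette i a ≡ palette j b → i ≡ j × a ≡ b
palette-injective zero zero a b eq = refl , classIndex-injective a b (ℕ.suc-injective eq)
palette-injective zero (suc j) a b eq = ⊥-elim (small-vs-large a j b eq)
  where
  small-vs-large : ∀ a j b → suc (classIndex a) ≢ 3 + palette j b
  small-vs-large 0₃ j b ()
  small-vs-large 1₃ j b ()
  small-vs-large 2₃ j b eq = ℕ.<-irrefl (ℕ.suc-injective (ℕ.suc-injective (ℕ.suc-injective eq))) (palette-≥1 j b)
palette-injective (suc i) zero a b eq with palette-injective zero (suc i) b a (sym eq)
... | () , _
palette-injective (suc i) (suc j) a b eq with palette-injective i j a b (ℕ.+-cancelˡ-≡ 3 _ _ eq)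
... | i≡j , a≡b = cong suc i≡j , a≡b

-- The (j+1)-st request to a node of class a, when k = ⌈Opt/2⌉: the first k
-- requests use the own palette, the later ones borrow from the next class
-- in reverse order.
mirror : ℕ → ℕ → ℕ
mirror k j = k + k ℕ.∸ suc j

colour : ℕ → ℕ → ℤ₃ → ℕ
colour k j a with j <? k
... | yes _ = palette j a
... | no _  = palette (mirror k j) (suc₃ a)

colour-below : ∀ {k j} a → j < k → colour k j a ≡ palette j a
colour-below {k} {j} a j<k with j <? k
... | yes _   = refl
... | no j≮k = contradiction j<k j≮k

borrowed-index : ∀ {k j} → k ≤ j → suc j ≤ k + k → mirror k j < k
borrowed-index {zero} _ j<0 = contradiction j<0 λ ()
borrowed-index {suc k} {j} k≤j _ = ℕ.≤-<-trans (ℕ.∸-monoʳ-≤ (suc k + suc k) (s≤s k≤j))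
  (subst (_< suc k) (sym (ℕ.m+n∸n≡m k (suc k))) (ℕ.n<1+n k))

colour-range : ∀ k j a → suc j ≤ k + k → 1 ≤ colour k j a × colour k j a ≤ 3 * k
colour-range k j a j<2k with j <? k
... | yes j<k = palette-≥1 j a , ℕ.≤-trans (palette-≤ j a) (ℕ.*-monoʳ-≤ 3 j<k)
... | no j≮k  = palette-≥1 (mirror k j) (suc₃ a) ,
                ℕ.≤-trans (palette-≤ (mirror k j) (suc₃ a)) (ℕ.*-monoʳ-≤ 3 (borrowed-index (ℕ.≮⇒≥ j≮k) j<2k))

colour-distinct-same : ∀ k {x y} a → x < y → suc y ≤ k + k → colour k x a ≢ colour k y a
colour-distinct-same k {x} {y} a x<y y<2k with x <? k | y <? k
... | yes _ | yes _ = λ eq → ℕ.<-irrefl (proj₁ (palette-injective x y a a eq)) x<y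
... | yes _ | no _  = λ eq → suc₃-moves a (sym (proj₂ (palette-injective x (mirror k y) a (suc₃ a) eq)))
... | no _  | yes _ = λ eq → suc₃-moves a (proj₂ (palette-injective (mirror k x) y (suc₃ a) a eq))
... | no _  | no _  = λ eq → ℕ.<-irrefl (mirror-injective (proj₁ (palette-injective (mirror k x) (mirror k y) (suc₃ a) (suc₃ a) eq))) x<y
  where
  mirror-injective : mirror k x ≡ mirror k y → x ≡ y
  mirror-injective = ℕ.suc-injective ∘ ℕ.∸-cancelˡ-≡ (ℕ.≤-trans x<y (ℕ.≤-trans (ℕ.n≤1+n y) y<2k)) y<2k

-- Requests to nodes of different classes, together fewer than 2k, get
-- different colours: a borrowed colour 2k-1-y never meets an own colour x.
colour-distinct-adjacent : ∀ k {x y a b} → a ≢ b → suc x + suc y ≤ k + k → colour k x a ≢ colour k y b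
colour-distinct-adjacent k {x} {y} {a} {b} a≢b bound with x <? k | y <? k
... | yes _ | yes _ = λ eq → a≢b (proj₂ (palette-injective x y a b eq))
... | yes _ | no _  = λ eq → ℕ.<-irrefl (proj₁ (palette-injective x (mirror k y) a (suc₃ b) eq)) (ℕ.m+n≤o⇒m≤o∸n (suc x) bound)
... | no _  | yes _ = λ eq → ℕ.<-irrefl (sym (proj₁ (palette-injective (mirror k x) y (suc₃ a) b eq)))
                               (ℕ.m+n≤o⇒m≤o∸n (suc y) (subst (_≤ k + k) (ℕ.+-comm (suc x) (suc y)) bound))
... | no _  | no _  = λ eq → a≢b (trans (sym (pred₃-suc₃ a))
                               (trans (cong pred₃ (proj₂ (palette-injective (mirror k x) (mirror k y) (suc₃ a) (suc₃ b) eq))) (pred₃-suc₃ b)))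

offline : (List Cell → Cell → ℕ) → List Cell → List Cell → List ℕ
offline g pre [] = []
offline g pre (v ∷ vs) = g pre v ∷ offline g (pre ++ [ v ]) vs

length-offline : ∀ g pre vs → length (offline g pre vs) ≡ length vs
length-offline g pre [] = refl
length-offline g pre (v ∷ vs) = cong suc (length-offline g (pre ++ [ v ]) vs)

_⊑_ : List A → List A → Set
xs ⊑ ys = Σ (List _) λ zs → xs ++ zs ≡ ys

⊑-refl : ∀ (xs : List A) → xs ⊑ xs
⊑-refl xs = [] , ++-identityʳ xs

⊑-snoc : ∀ (xs : List A) v → xs ⊑ (xs ++ [ v ])
⊑-snoc xs v = [ v ] , refl

⊑-trans : ∀ {xs ys zs : List A} → xs ⊑ ys → ys ⊑ zs → xs ⊑ zs
⊑-trans {xs = xs} (as , refl) (bs , refl) = as ++ bs , sym (++-assoc xs as bs)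

snoc-⊑ : ∀ {pre vs rs} {v : A} → pre ++ v ∷ vs ≡ rs → (pre ++ [ v ]) ⊑ rs
snoc-⊑ {pre = pre} {vs} {v = v} eq = vs , trans (++-assoc pre [ v ] vs) eq

Compatible : Cell × ℕ → Cell × ℕ → Set
Compatible p p' = Conflict (proj₁ p) (proj₁ p') → proj₂ p ≢ proj₂ p'

offline-proper : ∀ {g rs} →
  (∀ {pre v pre' x} → (pre ++ [ v ]) ⊑ pre' → (pre' ++ [ x ]) ⊑ rs → Conflict v x → g pre v ≢ g pre' x) →
  AllPairs Compatible (zip rs (offline g [] rs))
offline-proper {g} {rs} separates = go [] rs refl
  where
  go : ∀ pre vs → pre ++ vs ≡ rs → AllPairs Compatible (zip vs (offline g pre vs))
  go pre [] _ = []
  go pre (v ∷ vs) eq =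
    against (pre ++ [ v ]) vs (⊑-refl (pre ++ [ v ])) (proj₂ (snoc-⊑ eq)) ∷ go (pre ++ [ v ]) vs (proj₂ (snoc-⊑ eq))
    where
    against : ∀ pre' ws → (pre ++ [ v ]) ⊑ pre' → pre' ++ ws ≡ rs →
              All (Compatible (v , g pre v)) (zip ws (offline g pre' ws))
    against pre' [] _ _ = []
    against pre' (x ∷ ws) earlier eq' =
      separates earlier (snoc-⊑ eq') ∷ against (pre' ++ [ x ]) ws (⊑-trans earlier (⊑-snoc pre' x)) (proj₂ (snoc-⊑ eq'))

offline-All : ∀ {P : ℕ → Set} {g rs} → (∀ {pre v} → (pre ++ [ v ]) ⊑ rs → P (g pre v)) → All P (offline g [] rs)
offline-All {P} {g} {rs} holds = go [] rs refl
  where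
  go : ∀ pre vs → pre ++ vs ≡ rs → All P (offline g pre vs)
  go pre [] _ = []
  go pre (v ∷ vs) eq = holds (snoc-⊑ eq) ∷ go (pre ++ [ v ]) vs (proj₂ (snoc-⊑ eq))

All-zip-proj₂ : ∀ {P : B → Set} (xs : List A) {ys} → All P ys → All (λ p → P (proj₂ p)) (zip xs ys)
All-zip-proj₂ [] _ = []
All-zip-proj₂ (x ∷ xs) [] = []
All-zip-proj₂ (x ∷ xs) (py ∷ pys) = py ∷ All-zip-proj₂ xs pys

request-rank : ∀ {pre v ys} → (pre ++ [ v ]) ⊑ ys → suc (count v pre) ≤ count v ys
request-rank {pre} {v} (zs , refl) = begin
  suc (count v pre)                       ≡⟨ ℕ.+-comm 1 (count v pre) ⟩
  count v pre + 1                         ≡⟨ cong (λ n → count v pre + n) (sym (cong length (filter-accept (_≟ᶜ v) refl))) ⟩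
  count v pre + count v [ v ]             ≡⟨ sym (count-++ v pre [ v ]) ⟩
  count v (pre ++ [ v ])                  ≤⟨ ℕ.m≤m+n _ _ ⟩
  count v (pre ++ [ v ]) + count v zs     ≡⟨ sym (count-++ v (pre ++ [ v ]) zs) ⟩
  count v ((pre ++ [ v ]) ++ zs)          ∎
  where open ℕ.≤-Reasoning

scheme : ℕ → List Cell → Cell → ℕ
scheme k pre v = colour k (count v pre) (cellClass v)

module _ {rs : List Cell} {opt k : ℕ} (isOpt : IsOpt rs opt) (opt≤2k : opt ≤ k + k) where

  -- conflicting requests get distinct colours, by the clique bounds
  scheme-separates : ∀ {pre v pre' x} → (pre ++ [ v ]) ⊑ pre' → (pre' ++ [ x ]) ⊑ rs →
                     Conflict v x → scheme k pre v ≢ scheme k pre' x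
  scheme-separates earlier later (inj₁ refl) =
    colour-distinct-same k _ (request-rank earlier)
      (ℕ.≤-trans (request-rank later) (ℕ.≤-trans (occurrences-≤-opt isOpt _) opt≤2k))
  scheme-separates {v = v} {x = x} earlier later (inj₂ adj) =
    colour-distinct-adjacent k (adjacent-classes-differ v x adj)
      (ℕ.≤-trans (ℕ.+-mono-≤ (request-rank (⊑-trans earlier (⊑-trans (⊑-snoc _ _) later))) (request-rank later))
        (ℕ.≤-trans (adjacent-occurrences-≤-opt isOpt v x adj) opt≤2k))

  scheme-range : All (λ c → 1 ≤ c × c ≤ 3 * k) (offline (scheme k) [] rs)
  scheme-range = offline-All λ {pre} {v} placed →
    colour-range k _ (cellClass v) (ℕ.≤-trans (request-rank placed) (ℕ.≤-trans (occurrences-≤-opt isOpt v) opt≤2k))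

  scheme-colouring : IsColouring rs (offline (scheme k) [] rs)
  scheme-colouring = length-offline (scheme k) [] rs ,
                     All-zip-proj₂ rs (All.map proj₁ scheme-range) ,
                     offline-proper scheme-separates

  scheme-colours : numColours (offline (scheme k) [] rs) ≤ 3 * k
  scheme-colours = subst (numColours cs ≤_) (length-applyUpTo suc (3 * k))
    (unique-⊆-length (deduplicate-! cs) λ {z} z∈ → inRange (All.lookup scheme-range (∈-deduplicate⁻ ℕ._≟_ cs z∈)))
    where
    cs = offline (scheme k) [] rs
    inRange : ∀ {z} → 1 ≤ z × z ≤ 3 * k → z ∈ applyUpTo suc (3 * k)
    inRange (s≤s _ , z≤3k) = ∈-applyUpTo⁺ suc z≤3k

mapQ : (A → B) → Query A → Query B
mapQ g (answer a) = answer (g a)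
mapQ g (read p k) = read p (λ b → mapQ g (k b))

bindQ : Query A → (A → Query B) → Query B
bindQ (answer a) f = f a
bindQ (read p k) f = read p (λ b → bindQ (k b) f)

shift : Query A → Query A
shift (answer a) = answer a
shift (read p k) = read (suc p) (λ b → shift (k b))

shiftBy : ℕ → Query A → Query A
shiftBy zero q = q
shiftBy (suc m) q = shift (shiftBy m q)

_++ₜ_ : ∀ {m} → Vec Bool m → Tape → Tape
([] ++ₜ t) p = t p
((b ∷ bs) ++ₜ t) zero = b
((b ∷ bs) ++ₜ t) (suc p) = (bs ++ₜ t) p

infixr 5 _++ₜ_

blank : Tape
blank _ = false

record Yields (t : Tape) (q : Query A) (a : A) (n : ℕ) : Set where
  constructor yields
  field
    result : eval q t ≡ a
    within : ReadsWithin n q t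

yields-answer : ∀ {t n} (a : A) → Yields t (answer a) a n
yields-answer a = yields refl tt

yields-read : ∀ {t p n a} {k : Bool → Query A} → suc p ≤ n → Yields t (k (t p)) a n → Yields t (read p k) a n
yields-read p<n (yields ev reads) = yields ev (p<n , reads)

yields-result : ∀ {t n a a'} {q : Query A} → a ≡ a' → Yields t q a n → Yields t q a' n
yields-result refl y = y

yields-mono : ∀ {t m n a} (q : Query A) → m ≤ n → Yields t q a m → Yields t q a n
yields-mono (answer _) _ (yields ev _) = yields ev tt
yields-mono {t = t} (read p k) m≤n (yields ev (p<m , reads)) =
  yields-read (ℕ.≤-trans p<m m≤n) (yields-mono (k (t p)) m≤n (yields ev reads))

yields-map : ∀ {t n a} (g : A → B) (q : Query A) → Yields t q a n → Yields t (mapQ g q) (g a) n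
yields-map g (answer _) (yields refl _) = yields refl tt
yields-map {t = t} g (read p k) (yields ev (p<n , reads)) =
  yields-read p<n (yields-map g (k (t p)) (yields ev reads))

yields-bind : ∀ {t n a b} (q : Query A) {f : A → Query B} →
              Yields t q a n → Yields t (f a) b n → Yields t (bindQ q f) b n
yields-bind (answer _) (yields refl _) y = y
yields-bind {t = t} (read p k) (yields ev (p<n , reads)) y =
  yields-read p<n (yields-bind (k (t p)) (yields ev reads) y)

yields-shift : ∀ {t n a} (q : Query A) → Yields (λ p → t (suc p)) q a n → Yields t (shift q) a (suc n)
yields-shift (answer _) (yields ev _) = yields ev tt
yields-shift {t = t} (read p k) (yields ev (p<n , reads)) =
  yields-read (s≤s p<n) (yields-shift (k (t (suc p))) (yields ev reads))

yields-shiftBy : ∀ {m t n a} (bs : Vec Bool m) (q : Query A) →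
                 Yields t q a n → Yields (bs ++ₜ t) (shiftBy m q) a (m + n)
yields-shiftBy [] q y = y
yields-shiftBy {m = suc m} {t = t} (b ∷ bs) q y =
  yields-shift {t = (b ∷ bs) ++ₜ t} (shiftBy m q) (yields-shiftBy bs q y)

unaryCode : (c : ℕ) → Vec Bool (suc c)
unaryCode zero = false ∷ []
unaryCode (suc c) = true ∷ unaryCode c

readUnary : ℕ → Query (Maybe ℕ)
readUnary zero = answer nothing
readUnary (suc f) = read 0 (λ b → if b then shift (mapQ (Maybe.map suc) (readUnary f)) else answer (just 0))

data Attempt (f c : ℕ) (a : A) : Maybe A → Set where
  found  : c < f → Attempt f c a (just a)
  gaveUp : f ≤ c → Attempt f c a nothing

readUnary-spec : ∀ f c t → Σ (Maybe ℕ) λ r → Attempt f c c r × Yields (unaryCode c ++ₜ t) (readUnary f) r (suc c)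
readUnary-spec zero c t = nothing , gaveUp z≤n , yields-answer nothing
readUnary-spec (suc f) zero t = just 0 , found z<s , yields-read (s≤s z≤n) (yields-answer (just 0))
readUnary-spec (suc f) (suc c) t with readUnary-spec f c t
... | r , attempt , y = Maybe.map suc r , attempt-suc attempt ,
      yields-read (s≤s z≤n) (yields-shift (mapQ (Maybe.map suc) (readUnary f)) (yields-map (Maybe.map suc) (readUnary f) y))
  where
  attempt-suc : ∀ {r} → Attempt f c c r → Attempt (suc f) (suc c) (suc c) (Maybe.map suc r)
  attempt-suc (found c<f) = found (s≤s c<f)
  attempt-suc (gaveUp f≤c) = gaveUp (s≤s f≤c)

bitValue : Bool → ℕ
bitValue false = 0
bitValue true = 1

odd : ℕ → Bool
odd zero = false
odd (suc zero) = true
odd (suc (suc n)) = odd n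

odd-halve : ∀ n → bitValue (odd n) + 2 * ⌊ n /2⌋ ≡ n
odd-halve zero = refl
odd-halve (suc zero) = refl
odd-halve (suc (suc n)) = trans (regroup (bitValue (odd n)) ⌊ n /2⌋) (cong (λ n → 2 + n) (odd-halve n))
  where
  regroup : ∀ b h → b + 2 * suc h ≡ 2 + (b + 2 * h)
  regroup = ℕ-Solver.solve-∀

halve-< : ∀ n x → x < 2 ^ suc n → ⌊ x /2⌋ < 2 ^ n
halve-< n x x<2^sn = ℕ.*-cancelˡ-< 2 ⌊ x /2⌋ (2 ^ n)
  (ℕ.≤-<-trans (ℕ.m≤n+m (2 * ⌊ x /2⌋) (bitValue (odd x))) (subst (_< 2 ^ suc n) (sym (odd-halve x)) x<2^sn))

bits : (n : ℕ) → ℕ → Vec Bool n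
bits zero x = []
bits (suc n) x = odd x ∷ bits n ⌊ x /2⌋

readBits : ℕ → Query ℕ
readBits zero = answer 0
readBits (suc n) = read 0 (λ b → shift (mapQ (λ v → bitValue b + 2 * v) (readBits n)))

readBits-spec : ∀ n x t → x < 2 ^ n → Yields (bits n x ++ₜ t) (readBits n) x n
readBits-spec zero zero t _ = yields-answer 0
readBits-spec zero (suc x) t (s≤s ())
readBits-spec (suc n) x t x<2^sn =
  yields-read (s≤s z≤n) (yields-result (odd-halve x)
    (yields-shift (mapQ _ (readBits n)) (yields-map _ (readBits n) (readBits-spec n ⌊ x /2⌋ t (halve-< n x x<2^sn)))))

frame : ℕ → ℕ → ℕ → Tape
frame c L k = unaryCode c ++ₜ bits (suc c) L ++ₜ bits L k ++ₜ blank

readPayload : ℕ → Query ℕ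
readPayload c = bindQ (readBits (suc c)) (λ L → shiftBy (suc c) (readBits L))

decode : ℕ → Query (Maybe ℕ)
decode f = bindQ (readUnary f) (maybe (λ c → shiftBy (suc c) (mapQ just (readPayload c))) (answer nothing))

readPayload-spec : ∀ c L k t → L < 2 ^ suc c → k < 2 ^ L →
                   Yields (bits (suc c) L ++ₜ bits L k ++ₜ t) (readPayload c) k (suc c + L)
readPayload-spec c L k t L-fits k-fits =
  yields-bind (readBits (suc c)) (yields-mono (readBits (suc c)) (ℕ.m≤m+n (suc c) L) (readBits-spec (suc c) L _ L-fits))
    (yields-shiftBy (bits (suc c) L) (readBits L) (readBits-spec L k t k-fits))

decode-spec : ∀ f c L k → L < 2 ^ suc c → k < 2 ^ L →
  Σ (Maybe ℕ) λ r → Attempt f c k r × Yields (frame c L k) (decode f) r (suc c + (suc c + L))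
decode-spec f c L k L-fits k-fits with readUnary-spec f c (bits (suc c) L ++ₜ bits L k ++ₜ blank)
... | _ , found c<f , y = just k , found c<f ,
      yields-bind (readUnary f) (yields-mono (readUnary f) (ℕ.m≤m+n (suc c) _) y)
        (yields-shiftBy (unaryCode c) (mapQ just (readPayload c))
          (yields-map just (readPayload c) (readPayload-spec c L k blank L-fits k-fits)))
... | _ , gaveUp f≤c , y = nothing , gaveUp f≤c ,
      yields-bind (readUnary f) (yields-mono (readUnary f) (ℕ.m≤m+n (suc c) _) y) (yields-answer nothing)

n≤2⌈n/2⌉ : ∀ n → n ≤ ⌈ n /2⌉ + ⌈ n /2⌉
n≤2⌈n/2⌉ n = subst (_≤ ⌈ n /2⌉ + ⌈ n /2⌉) (ℕ.⌊n/2⌋+⌈n/2⌉≡n n) (ℕ.+-monoˡ-≤ ⌈ n /2⌉ (ℕ.⌊n/2⌋≤⌈n/2⌉ n))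

pow-ceil-log : ∀ n → n ≤ 2 ^ ⌈log₂ n ⌉
pow-ceil-log n = go n (<-wellFounded n)
  where
  go : ∀ n (rec : Acc _<_ n) → n ≤ 2 ^ ⌈log2⌉ n rec
  go zero _ = z≤n
  go (suc zero) _ = s≤s z≤n
  go (suc (suc m)) (acc rs) = begin
    suc (suc m)                             ≤⟨ s≤s (twice-ceil m) ⟩
    suc ⌈ m /2⌉ + suc ⌈ m /2⌉               ≤⟨ ℕ.+-mono-≤ ih (ℕ.≤-trans ih (ℕ.≤-reflexive (sym (ℕ.*-identityˡ _)))) ⟩
    2 ^ suc (⌈log2⌉ (suc ⌈ m /2⌉) _)        ∎
    where
    open ℕ.≤-Reasoning
    ih = go (suc ⌈ m /2⌉) _
    twice-ceil : ∀ m → suc m ≤ ⌈ m /2⌉ + suc ⌈ m /2⌉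
    twice-ceil m = subst (suc m ≤_) (sym (ℕ.+-suc ⌈ m /2⌉ ⌈ m /2⌉)) (s≤s (n≤2⌈n/2⌉ m))

-- L(k) bits hold k; M(k) bits hold L(k); ⟦ k ⟧ = L(k) + 2 M(k).
valueLength lengthLength : ℕ → ℕ
valueLength k = ⌈log₂ (suc k) ⌉
lengthLength k = ⌈log₂ (suc (valueLength k)) ⌉

lengthLength-mono : ∀ {j k} → j ≤ k → lengthLength j ≤ lengthLength k
lengthLength-mono j≤k = ⌈log₂⌉-mono-≤ (s≤s (⌈log₂⌉-mono-≤ (s≤s j≤k)))

lengthLength-pos : ∀ {k} → 1 ≤ k → 1 ≤ lengthLength k
lengthLength-pos k≥1 = ⌈log₂⌉-mono-≤ {2} (s≤s (⌈log₂⌉-mono-≤ {2} (s≤s k≥1)))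

-- the unary part M(k) - 1 is followed by M(k) bits for L(k)
suc-pred : ∀ {n} → 1 ≤ n → suc (pred n) ≡ n
suc-pred (s≤s _) = refl

advice : ℕ → Tape
advice k = frame (pred (lengthLength k)) (valueLength k) k

valueLength-fits : ∀ k → k < 2 ^ valueLength k
valueLength-fits k = pow-ceil-log (suc k)

lengthLength-fits : ∀ {k} → 1 ≤ k → valueLength k < 2 ^ suc (pred (lengthLength k))
lengthLength-fits {k} k≥1 =
  subst (λ m → valueLength k < 2 ^ m) (sym (suc-pred (lengthLength-pos k≥1))) (pow-ceil-log (suc (valueLength k)))

advice-size : ∀ {m} → 1 ≤ m → ∀ l → suc (pred m) + (suc (pred m) + l) ≡ l + 2 * m
advice-size {suc m} _ l = regroup (suc m) l
  where
  regroup : ∀ m l → m + (m + l) ≡ l + 2 * m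
  regroup = ℕ-Solver.solve-∀

advice-spec : ∀ {k} → 1 ≤ k → ∀ f →
  Σ (Maybe ℕ) λ r → Attempt f (pred (lengthLength k)) k r × Yields (advice k) (decode f) r ⟦ k ⟧
advice-spec {k} k≥1 f =
  let r , attempt , y = decode-spec f (pred (lengthLength k)) (valueLength k) k (lengthLength-fits k≥1) (valueLength-fits k)
  in r , attempt , yields-mono (decode f) (ℕ.≤-reflexive (advice-size (lengthLength-pos k≥1) (valueLength k))) y

-- The colour of request j of class a given the outcome of decoding;
-- giving up means k > j, so the own palette is the right one.
respond : ℕ → ℤ₃ → Maybe ℕ → ℕ
respond j a nothing = palette j a
respond j a (just k) = colour k j a

-- With j earlier requests to v, decode the advice with budget
-- lengthLength j, which suffices to learn k whenever k ≤ j.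
algorithm : OnlineAlg
algorithm G pre v = mapQ (respond (count v pre) (cellClass v)) (decode (lengthLength (count v pre)))

-- the response is the scheme's colour: giving up with budget M(j) means
-- M(j) ≤ M(k) - 1, so j < k by monotonicity of M
respond-correct : ∀ {j k r} a → 1 ≤ k → Attempt (lengthLength j) (pred (lengthLength k)) k r →
                  respond j a r ≡ colour k j a
respond-correct a k≥1 (found _) = refl
respond-correct {j} {k} a k≥1 (gaveUp budget) = sym (colour-below a (ℕ.≰⇒> k≰j))
  where
  k≰j : ¬ k ≤ j
  k≰j k≤j = ℕ.n≮n (pred (lengthLength k))
    (ℕ.≤-trans (ℕ.≤-reflexive (suc-pred (lengthLength-pos k≥1))) (ℕ.≤-trans (lengthLength-mono k≤j) budget))

algorithm-step : ∀ {k} → 1 ≤ k → ∀ G pre v → Yields (advice k) (algorithm G pre v) (scheme k pre v) ⟦ k ⟧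
algorithm-step k≥1 G pre v with advice-spec k≥1 (lengthLength (count v pre))
... | r , attempt , y = yields-result (respond-correct (cellClass v) k≥1 attempt)
                          (yields-map (respond (count v pre) (cellClass v)) (decode (lengthLength (count v pre))) y)

run-follows : ∀ {alg t G b g} → (∀ pre v → Yields t (alg G pre v) (g pre v) b) →
  ∀ rs → run alg t G rs ≡ offline g [] rs × AdviceWithin alg t G rs b
run-follows {alg} {t} {G} {b} {g} step rs = go [] rs
  where
  go : ∀ pre vs → map (λ q → eval q t) (steps alg G pre vs) ≡ offline g pre vs
                 × All (λ q → ReadsWithin b q t) (steps alg G pre vs)
  go pre [] = refl , []
  go pre (v ∷ vs) = cong₂ _∷_ (Yields.result (step pre v)) (proj₁ (go (pre ++ [ v ]) vs)) ,
                    Yields.within (step pre v) ∷ proj₂ (go (pre ++ [ v ]) vs)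

⌈n/2⌉-pos : ∀ {n} → 1 ≤ n → 1 ≤ ⌈ n /2⌉
⌈n/2⌉-pos (s≤s _) = s≤s z≤n

three-halves : ∀ opt c → c ≤ 3 * ⌈ opt /2⌉ → 2 * c ≤ 3 * opt + 3
three-halves opt c c≤3k = begin
  2 * c                        ≤⟨ ℕ.*-monoʳ-≤ 2 c≤3k ⟩
  2 * (3 * k)                  ≡⟨ regroup k ⟩
  3 * (k + k)                  ≤⟨ ℕ.*-monoʳ-≤ 3 2k≤opt+1 ⟩
  3 * suc opt                  ≡⟨ ℕ.*-suc 3 opt ⟩
  3 + 3 * opt                  ≡⟨ ℕ.+-comm 3 (3 * opt) ⟩
  3 * opt + 3                  ∎
  where
  open ℕ.≤-Reasoning
  k = ⌈ opt /2⌉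
  regroup : ∀ k → 2 * (3 * k) ≡ 3 * (k + k)
  regroup = ℕ-Solver.solve-∀
  2k≤opt+1 : k + k ≤ suc opt
  2k≤opt+1 = subst (k + k ≤_) (ℕ.⌊n/2⌋+⌈n/2⌉≡n (suc opt)) (ℕ.+-monoʳ-≤ k (ℕ.⌈n/2⌉-mono (ℕ.n≤1+n opt)))

theorem9 : Σ OnlineAlg λ A → Σ ℕ λ α →
  (G : HexGraph) (rs : List Cell) → ValidRequests G rs →
  (opt : ℕ) → IsOpt rs opt →
  Σ Tape λ t →
    IsColouring rs (run A t G rs)
    × (2 * numColours (run A t G rs) ≤ 3 * opt + α)
    × AdviceWithin A t G rs ⟦ ⌈ opt /2⌉ ⟧
theorem9 = algorithm , 3 , guarantee
  where
  guarantee : (G : HexGraph) (rs : List Cell) → ValidRequests G rs → (opt : ℕ) → IsOpt rs opt →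
    Σ Tape λ t → IsColouring rs (run algorithm t G rs) × (2 * numColours (run algorithm t G rs) ≤ 3 * opt + 3)
                 × AdviceWithin algorithm t G rs ⟦ ⌈ opt /2⌉ ⟧
  guarantee G [] _ opt _ = blank , (refl , [] , []) , z≤n , []
  guarantee G rs@(v ∷ vs) _ opt isOpt =
    advice k ,
    subst (IsColouring rs) (sym runs) (scheme-colouring {k = k} isOpt opt≤2k) ,
    subst (λ cs → 2 * numColours cs ≤ 3 * opt + 3) (sym runs) (three-halves opt _ (scheme-colours {k = k} isOpt opt≤2k)) ,
    reads
    where
    k = ⌈ opt /2⌉
    opt≤2k = n≤2⌈n/2⌉ opt
    -- a request exists, so opt ≥ 1 and k ≥ 1
    k≥1 : 1 ≤ k
    k≥1 = ⌈n/2⌉-pos (ℕ.≤-trans (request-rank {pre = []} {v = v} (vs , refl)) (occurrences-≤-opt isOpt v))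
    follows = run-follows (algorithm-step k≥1 G) rs
    runs = proj₁ follows
    reads = proj₂ follows
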